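{- Let $d\geq 1$, $\eta\in (0,1)$ and $\varepsilon\in (0,\frac{1}{2}]$. Let $G$ be a $(d, \eta, \varepsilon)$-expander on $n$ vertices. Then $\Phi_G \geq \frac{\eta}{3}$.
   Context: For a graph $G$, $d(G)$ is its average degree and for $S\subseteq V(G)$, $d(S)$ is the average degree of $G[S]$. A graph $G$ is $d$-minimal if $d(G)\ge d$ but $d(H)<d$ for every proper subgraph $H$. An $n$-vertex graph $G$ is a $(d,\eta,\varepsilon)$-expander if $G$ is $d$-minimal and every $S\subseteq V(G)$ with $|S|\le(1-\varepsilon)n$ satisfies $d(S)\le(1-\eta)d$. For a graph $G$ with $m$ edges, let $\pi(v)=\frac{d(v)}{2m}$ and $\pi(S)=\sum_{s\in S}\pi(s)$; the conductance of $S$ is $\Phi(S)=\frac{e(S,S^c)}{2m\,\pi(S)\pi(S^c)}$, where $e(S,S^c)$ is the number of edges between $S$ and its complement, and $\Phi_G=\min_S \Phi(S)$ over nonempty proper subsets $S\subsetneq V(G)$.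
   Formalization: The parameters d, η and ε of the expander take rational values. -}

module Defs where

open import Data.Nat as ℕ using (ℕ; zero; suc)
open import Data.Integer using (+_)
open import Data.Rational using (ℚ; _/_; 0ℚ; 1ℚ; _≤_; _<_; _-_; _*_)
open import Data.Bool using (Bool; true; false; _∧_; not)
open import Data.Fin using (Fin)
open import Data.Fin.Subset using (Subset; _∈_; _∉_; ∣_∣; ⊤)
open import Data.Vec using (lookup)
open import Data.Product using (_×_; ∃)
open import Relation.Binary.PropositionalEquality using (_≡_)
open import Relation.Nullary using (¬_)

record Graph (n : ℕ) : Set where
  field
    adj    : Fin n → Fin n → Bool
    sym    : ∀ i j → adj i j ≡ adj j i
    irrefl : ∀ i → adj i i ≡ false
open Graph public

b2n : Bool → ℕ
b2n true  = 1
b2n false = 0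

Σ : (n : ℕ) → (Fin n → ℕ) → ℕ
Σ zero    f = 0
Σ (suc n) f = f Fin.zero ℕ.+ Σ n (λ i → f (Fin.suc i))
  where import Data.Fin as Fin

-- fraction a / b in ℚ, with the convention a / 0 = 0 (only used where b > 0 in the relevant cases)
frac : ℕ → ℕ → ℚ
frac a zero    = 0ℚ
frac a (suc b) = + a / suc b

record Subgraph {n : ℕ} (G : Graph n) : Set where
  field
    verts  : Subset n
    edges  : Fin n → Fin n → Bool
    esym   : ∀ i j → edges i j ≡ edges j i
    eInG   : ∀ i j → edges i j ≡ true → adj G i j ≡ true
    eInS   : ∀ i j → edges i j ≡ true → (lookup verts i ≡ true) × (lookup verts j ≡ true)
open Subgraph public

Proper : ∀ {n} {G : Graph n} → Subgraph G → Set
Proper {n} {G} H = ¬ ((verts H ≡ ⊤) × (∀ i j → edges H i j ≡ adj G i j))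

-- average degree of a graph with vertex set V and edge set E: 2|E|/|V| (0 if V empty)
avgDegSub : ∀ {n} {G : Graph n} → Subgraph G → ℚ
avgDegSub {n} H = frac (Σ n λ i → Σ n λ j → b2n (edges H i j)) ∣ verts H ∣

avgDeg : ∀ {n} → Graph n → ℚ
avgDeg {n} G = frac (Σ n λ i → Σ n λ j → b2n (adj G i j)) n

avgDegInd : ∀ {n} → Graph n → Subset n → ℚ
avgDegInd {n} G S =
  frac (Σ n λ i → Σ n λ j → b2n (lookup S i ∧ lookup S j ∧ adj G i j)) ∣ S ∣

Minimal : ∀ {n} → ℚ → Graph n → Set
Minimal d G = (d ≤ avgDeg G) × (∀ (H : Subgraph G) → Proper H → avgDegSub H < d)

Expander : ∀ {n} → ℚ → ℚ → ℚ → Graph n → Set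
Expander {n} d η ε G =
  Minimal d G ×
  (∀ (S : Subset n) → frac ∣ S ∣ 1 ≤ (1ℚ - ε) * frac n 1 → avgDegInd G S ≤ (1ℚ - η) * d)

degree : ∀ {n} → Graph n → Fin n → ℕ
degree {n} G v = Σ n λ j → b2n (adj G v j)

twoM : ∀ {n} → Graph n → ℕ
twoM {n} G = Σ n (degree G)

vol : ∀ {n} → Graph n → Subset n → ℕ
vol {n} G S = Σ n λ v → b2n (lookup S v) ℕ.* degree G v

cut : ∀ {n} → Graph n → Subset n → ℕ
cut {n} G S = Σ n λ i → Σ n λ j → b2n (lookup S i ∧ not (lookup S j) ∧ adj G i j)

-- Φ(S) = e(S,Sᶜ) / (2m π(S) π(Sᶜ)) = e(S,Sᶜ)·2m / (vol S · vol Sᶜ)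
conductance : ∀ {n} → Graph n → Subset n → ℚ
conductance G S =
  frac (cut G S ℕ.* twoM G) (vol G S ℕ.* vol G (Data.Fin.Subset.∁ S))
  where import Data.Fin.Subset

-- Φ_G ≥ c  (Φ_G is the minimum over nonempty proper S, so this unfolds to ∀ such S)
ConductanceAtLeast : ∀ {n} → Graph n → ℚ → Set
ConductanceAtLeast {n} G c =
  ∀ (S : Subset n) → (∃ λ i → i ∈ S) → (∃ λ j → j ∉ S) → c ≤ conductance G S

-- Let A and B count the ordered adjacent pairs inside S and inside Sᶜ, and C = e(S, Sᶜ); then
-- vol S = C + A, vol Sᶜ = C + B and 2m = vol S + vol Sᶜ, so Φ(S) = C (vol S + vol Sᶜ) / (vol S · vol Sᶜ).
-- Since Φ(Sᶜ) = Φ(S) we may assume |S| ≤ n/2 ≤ (1 - ε) n, and expansion gives A ≤ (1 - η) d |S|.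
-- Minimality gives B < d |Sᶜ|, as G[Sᶜ] is a proper subgraph, and d n ≤ 2m. Adding up, η d |S| < 2C,
-- hence η · vol S ≤ 3C, and Φ(S) ≥ C / vol S ≥ η / 3.
module Submission where

open import Defs renaming (sym to adj-sym)

module Counting where

  open import Data.Nat using (ℕ; zero; suc; _+_; _*_; _≤_; _<_; z≤n)
  open import Data.Nat.Properties
    using (+-comm; *-identityˡ; *-distribˡ-+; *-distribʳ-+; m+[n∸m]≡n; ≤-<-trans; ≤-total; +-monoʳ-≤)
    renaming (+-*-semiring to ℕ-semiring)
  open import Data.Bool using (Bool; true; false; _∧_; not)
  open import Data.Bool.Properties using (∧-assoc; ∧-comm; ∧-conicalˡ; ∧-conicalʳ; not-involutive)
  open import Data.Fin as Fin using (Fin)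
  open import Data.Fin.Subset using (Subset; ∁; _∈_; _∉_; ∣_∣)
  open import Data.Fin.Subset.Properties using (∈⊤; ∣p∣≤n; ∣∁p∣≡n∸∣p∣; x∈p⇒∣p-x∣<∣p∣)
  open import Data.Vec using (lookup)
  open import Data.Vec.Properties using (lookup-map; map-∘; map-cong; map-id)
  open import Data.Product using (_,_)
  open import Data.Sum using (_⊎_; inj₁; inj₂)
  open import Function using (_∘_)
  open import Relation.Binary.PropositionalEquality
  open import Algebra.Properties.Semiring.Sum ℕ-semiring
    using (sum; sum-cong-≗; ∑-distrib-+; ∑-comm; *-distribˡ-sum)

  Σ≡sum : ∀ n (f : Fin n → ℕ) → Σ n f ≡ sum f
  Σ≡sum zero    f = refl
  Σ≡sum (suc n) f = cong (f Fin.zero +_) (Σ≡sum n (f ∘ Fin.suc))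

  Σ-cong : ∀ n {f g : Fin n → ℕ} → (∀ i → f i ≡ g i) → Σ n f ≡ Σ n g
  Σ-cong n {f} {g} f≗g = trans (Σ≡sum n f) (trans (sum-cong-≗ f≗g) (sym (Σ≡sum n g)))

  Σ-distrib-+ : ∀ n (f g : Fin n → ℕ) → Σ n (λ i → f i + g i) ≡ Σ n f + Σ n g
  Σ-distrib-+ n f g =
    trans (Σ≡sum n _) (trans (∑-distrib-+ f g) (sym (cong₂ _+_ (Σ≡sum n f) (Σ≡sum n g))))

  Σ-comm : ∀ n (f : Fin n → Fin n → ℕ) → Σ n (λ i → Σ n (f i)) ≡ Σ n (λ j → Σ n (λ i → f i j))
  Σ-comm n f = begin
    Σ n (λ i → Σ n (f i))          ≡⟨ Σ-cong n (λ i → Σ≡sum n (f i)) ⟩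
    Σ n (λ i → sum (f i))          ≡⟨ Σ≡sum n _ ⟩
    sum (λ i → sum (f i))          ≡⟨ ∑-comm f ⟩
    sum (λ j → sum (λ i → f i j))  ≡⟨ Σ≡sum n _ ⟨
    Σ n (λ j → sum (λ i → f i j))  ≡⟨ Σ-cong n (λ j → Σ≡sum n _) ⟨
    Σ n (λ j → Σ n (λ i → f i j))  ∎
    where open ≡-Reasoning

  *-distribˡ-Σ : ∀ n x (f : Fin n → ℕ) → x * Σ n f ≡ Σ n (λ i → x * f i)
  *-distribˡ-Σ n x f = trans (cong (x *_) (Σ≡sum n f)) (trans (*-distribˡ-sum x f) (sym (Σ≡sum n _)))

  b2n-∧ : ∀ x y → b2n (x ∧ y) ≡ b2n x * b2n y
  b2n-∧ true  true  = refl
  b2n-∧ true  false = refl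
  b2n-∧ false y     = refl

  b2n-split : ∀ r y → b2n y ≡ b2n (r ∧ y) + b2n (not r ∧ y)
  b2n-split true  true  = refl
  b2n-split true  false = refl
  b2n-split false y     = refl

  b2n+b2n-not : ∀ r → b2n r + b2n (not r) ≡ 1
  b2n+b2n-not true  = refl
  b2n+b2n-not false = refl

  ∧-swap : ∀ x y z → x ∧ y ∧ z ≡ y ∧ x ∧ z
  ∧-swap x y z = trans (sym (∧-assoc x y z)) (trans (cong (_∧ z) (∧-comm x y)) (∧-assoc y x z))

  lookup-∁ : ∀ {n} (S : Subset n) i → lookup (∁ S) i ≡ not (lookup S i)
  lookup-∁ S i = lookup-map i not S

  ∁-involutive : ∀ {n} (S : Subset n) → ∁ (∁ S) ≡ S
  ∁-involutive S = trans (sym (map-∘ not not S)) (trans (map-cong not-involutive S) (map-id S))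

  ∣p∣+∣∁p∣≡n : ∀ {n} (p : Subset n) → ∣ p ∣ + ∣ ∁ p ∣ ≡ n
  ∣p∣+∣∁p∣≡n p = trans (cong (∣ p ∣ +_) (∣∁p∣≡n∸∣p∣ p)) (m+[n∸m]≡n (∣p∣≤n p))

  x∈p⇒∣p∣>0 : ∀ {n} {x : Fin n} {p : Subset n} → x ∈ p → 0 < ∣ p ∣
  x∈p⇒∣p∣>0 x∈p = ≤-<-trans z≤n (x∈p⇒∣p-x∣<∣p∣ x∈p)

  ∣p∣+∣p∣≤n⊎∣∁p∣+∣∁p∣≤n : ∀ {n} (p : Subset n) → ∣ p ∣ + ∣ p ∣ ≤ n ⊎ ∣ ∁ p ∣ + ∣ ∁ p ∣ ≤ n
  ∣p∣+∣p∣≤n⊎∣∁p∣+∣∁p∣≤n p with ≤-total ∣ p ∣ ∣ ∁ p ∣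
  ... | inj₁ p≤∁p = inj₁ (subst (∣ p ∣ + ∣ p ∣ ≤_) (∣p∣+∣∁p∣≡n p) (+-monoʳ-≤ ∣ p ∣ p≤∁p))
  ... | inj₂ ∁p≤p = inj₂ (subst (∣ ∁ p ∣ + ∣ ∁ p ∣ ≤_) (trans (+-comm ∣ ∁ p ∣ ∣ p ∣) (∣p∣+∣∁p∣≡n p))
                                (+-monoʳ-≤ ∣ ∁ p ∣ ∁p≤p))

  module _ {n} (G : Graph n) where

    -- cut G S is definitionally arcs (lookup S) (not ∘ lookup S), and the numerator of
    -- avgDegInd G T is arcs (lookup T) (lookup T).
    arcs : (Fin n → Bool) → (Fin n → Bool) → ℕ
    arcs P Q = Σ n λ i → Σ n λ j → b2n (P i ∧ Q j ∧ adj G i j)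

    degreeIn : (Fin n → Bool) → Fin n → ℕ
    degreeIn Q v = Σ n λ j → b2n (Q j ∧ adj G v j)

    arcs-cong : ∀ {P P′ Q Q′} → (∀ i → P i ≡ P′ i) → (∀ j → Q j ≡ Q′ j) → arcs P Q ≡ arcs P′ Q′
    arcs-cong P≗P′ Q≗Q′ = Σ-cong n λ i → Σ-cong n λ j →
      cong₂ (λ p q → b2n (p ∧ q ∧ adj G i j)) (P≗P′ i) (Q≗Q′ j)

    arcs-comm : ∀ P Q → arcs P Q ≡ arcs Q P
    arcs-comm P Q = trans (Σ-cong n λ i → Σ-cong n λ j → cong b2n (reverse i j)) (Σ-comm n _)
      where
      reverse : ∀ i j → P i ∧ Q j ∧ adj G i j ≡ Q j ∧ P i ∧ adj G j i
      reverse i j = trans (cong (λ e → P i ∧ Q j ∧ e) (adj-sym G i j)) (∧-swap (P i) (Q j) (adj G j i))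

    degree-split : ∀ Q v → degree G v ≡ degreeIn Q v + degreeIn (not ∘ Q) v
    degree-split Q v = trans (Σ-cong n λ j → b2n-split (Q j) (adj G v j)) (Σ-distrib-+ n _ _)

    arcs≡Σ-degreeIn : ∀ P Q → arcs P Q ≡ Σ n (λ i → b2n (P i) * degreeIn Q i)
    arcs≡Σ-degreeIn P Q = Σ-cong n λ i →
      trans (Σ-cong n λ j → b2n-∧ (P i) (Q j ∧ adj G i j)) (sym (*-distribˡ-Σ n (b2n (P i)) _))

    Σ-degree-split : ∀ P Q → Σ n (λ v → b2n (P v) * degree G v) ≡ arcs P Q + arcs P (not ∘ Q)
    Σ-degree-split P Q = begin
      Σ n (λ v → b2n (P v) * degree G v)
        ≡⟨ Σ-cong n (λ v → trans (cong (b2n (P v) *_) (degree-split Q v)) (*-distribˡ-+ (b2n (P v)) _ _)) ⟩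
      Σ n (λ v → b2n (P v) * degreeIn Q v + b2n (P v) * degreeIn (not ∘ Q) v)
        ≡⟨ Σ-distrib-+ n _ _ ⟩
      Σ n (λ v → b2n (P v) * degreeIn Q v) + Σ n (λ v → b2n (P v) * degreeIn (not ∘ Q) v)
        ≡⟨ cong₂ _+_ (arcs≡Σ-degreeIn P Q) (arcs≡Σ-degreeIn P (not ∘ Q)) ⟨
      arcs P Q + arcs P (not ∘ Q) ∎
      where open ≡-Reasoning

    vol≡cut+arcs : ∀ T → vol G T ≡ cut G T + arcs (lookup T) (lookup T)
    vol≡cut+arcs T = trans (Σ-degree-split (lookup T) (lookup T)) (+-comm (arcs (lookup T) (lookup T)) (cut G T))

    twoM≡vol+vol∁ : ∀ S → twoM G ≡ vol G S + vol G (∁ S)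
    twoM≡vol+vol∁ S = trans (Σ-cong n split) (Σ-distrib-+ n _ _)
      where
      split : ∀ v → degree G v ≡ b2n (lookup S v) * degree G v + b2n (lookup (∁ S) v) * degree G v
      split v = begin
        degree G v
          ≡⟨ *-identityˡ _ ⟨
        1 * degree G v
          ≡⟨ cong (_* degree G v) (b2n+b2n-not (lookup S v)) ⟨
        (b2n (lookup S v) + b2n (not (lookup S v))) * degree G v
          ≡⟨ cong (λ b → (b2n (lookup S v) + b2n b) * degree G v) (lookup-∁ S v) ⟨
        (b2n (lookup S v) + b2n (lookup (∁ S) v)) * degree G v
          ≡⟨ *-distribʳ-+ (degree G v) (b2n (lookup S v)) (b2n (lookup (∁ S) v)) ⟩
        b2n (lookup S v) * degree G v + b2n (lookup (∁ S) v) * degree G v ∎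
        where open ≡-Reasoning

    cut-∁ : ∀ S → cut G (∁ S) ≡ cut G S
    cut-∁ S = trans (arcs-cong (lookup-∁ S) (λ j → trans (cong not (lookup-∁ S j)) (not-involutive _)))
                    (arcs-comm (not ∘ lookup S) (lookup S))

    induced : Subset n → Subgraph G
    induced T = record
      { verts = T
      ; edges = λ i j → lookup T i ∧ lookup T j ∧ adj G i j
      ; esym  = λ i j → trans (cong (λ e → lookup T i ∧ lookup T j ∧ e) (adj-sym G i j))
                              (∧-swap (lookup T i) (lookup T j) (adj G j i))
      ; eInG  = λ i j e → ∧-conicalʳ (lookup T j) _ (∧-conicalʳ (lookup T i) _ e)
      ; eInS  = λ i j e → ∧-conicalˡ _ _ e , ∧-conicalˡ _ (adj G i j) (∧-conicalʳ (lookup T i) _ e)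
      }

    induced-proper : ∀ {T j} → j ∉ T → Proper (induced T)
    induced-proper j∉T (T≡⊤ , _) = j∉T (subst (_ ∈_) (sym T≡⊤) ∈⊤)

open Counting

open import Data.Nat as ℕ using (ℕ; zero; suc)
import Data.Nat.Properties as ℕ
open import Data.Integer as ℤ using (+_)
import Data.Integer.Properties as ℤ
open import Data.Rational hiding (∣_∣)
open import Data.Rational.Properties
import Data.Rational.Unnormalised as ℚᵘ
import Data.Rational.Unnormalised.Properties as ℚᵘ
open import Data.Rational.Solver using (module +-*-Solver)
open import Data.Fin.Subset using (Subset; ∁; _∈_; _∉_; ∣_∣)
open import Data.Fin.Subset.Properties using (x∈p⇒x∉∁p; x∉p⇒x∈∁p)
open import Data.Vec using (lookup)
open import Data.Product using (∃; _,_)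
open import Data.Sum using ([_,_]′)
open import Relation.Binary.PropositionalEquality
open import Relation.Nullary using (contradiction)
open +-*-Solver

fromℚᵘ-homo-+ : ∀ p q → fromℚᵘ (p ℚᵘ.+ q) ≡ fromℚᵘ p + fromℚᵘ q
fromℚᵘ-homo-+ p q = toℚᵘ-injective (ℚᵘ.≃-trans (toℚᵘ-fromℚᵘ (p ℚᵘ.+ q))
  (ℚᵘ.≃-sym (ℚᵘ.≃-trans (toℚᵘ-homo-+ (fromℚᵘ p) (fromℚᵘ q))
    (ℚᵘ.+-cong (toℚᵘ-fromℚᵘ p) (toℚᵘ-fromℚᵘ q)))))

fromℚᵘ-homo-* : ∀ p q → fromℚᵘ (p ℚᵘ.* q) ≡ fromℚᵘ p * fromℚᵘ q
fromℚᵘ-homo-* p q = toℚᵘ-injective (ℚᵘ.≃-trans (toℚᵘ-fromℚᵘ (p ℚᵘ.* q))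
  (ℚᵘ.≃-sym (ℚᵘ.≃-trans (toℚᵘ-homo-* (fromℚᵘ p) (fromℚᵘ q))
    (ℚᵘ.*-cong (toℚᵘ-fromℚᵘ p) (toℚᵘ-fromℚᵘ q)))))

fromℕ : ℕ → ℚ
fromℕ n = frac n 1

fromℕ-+ : ∀ m n → fromℕ (m ℕ.+ n) ≡ fromℕ m + fromℕ n
fromℕ-+ m n = trans
  (fromℚᵘ-cong {+ (m ℕ.+ n) ℚᵘ./ 1} {(+ m ℚᵘ./ 1) ℚᵘ.+ (+ n ℚᵘ./ 1)} (ℚᵘ.*≡* (cong (ℤ._* + 1)
    (trans (ℤ.pos-+ m n) (sym (cong₂ ℤ._+_ (ℤ.*-identityʳ (+ m)) (ℤ.*-identityʳ (+ n))))))))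
  (fromℚᵘ-homo-+ (+ m ℚᵘ./ 1) (+ n ℚᵘ./ 1))

fromℕ-* : ∀ m n → fromℕ (m ℕ.* n) ≡ fromℕ m * fromℕ n
fromℕ-* m n = trans
  (fromℚᵘ-cong {+ (m ℕ.* n) ℚᵘ./ 1} {(+ m ℚᵘ./ 1) ℚᵘ.* (+ n ℚᵘ./ 1)}
    (ℚᵘ.*≡* (cong (ℤ._* + 1) (ℤ.pos-* m n))))
  (fromℚᵘ-homo-* (+ m ℚᵘ./ 1) (+ n ℚᵘ./ 1))

frac-*-cancel : ∀ m n .{{_ : ℕ.NonZero n}} → frac m n * fromℕ n ≡ fromℕ m
frac-*-cancel m (suc n) = trans (sym (fromℚᵘ-homo-* (+ m ℚᵘ./ suc n) (+ suc n ℚᵘ./ 1)))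
  (fromℚᵘ-cong {(+ m ℚᵘ./ suc n) ℚᵘ.* (+ suc n ℚᵘ./ 1)} {+ m ℚᵘ./ 1}
    (ℚᵘ.*≡* (trans (ℤ.*-identityʳ _) (cong (λ k → + m ℤ.* + k) (sym (ℕ.*-identityʳ (suc n)))))))

fromℕ-nonNeg : ∀ n → NonNegative (fromℕ n)
fromℕ-nonNeg n = normalize-nonNeg n 1

fromℕ-pos : ∀ n .{{_ : ℕ.NonZero n}} → Positive (fromℕ n)
fromℕ-pos (suc n) = normalize-pos (suc n) 1

fromℕ≥0 : ∀ n → 0ℚ ≤ fromℕ n
fromℕ≥0 n = nonNegative⁻¹ (fromℕ n) {{fromℕ-nonNeg n}}

fromℕ-mono-≤ : ∀ {m n} → m ℕ.≤ n → fromℕ m ≤ fromℕ n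
fromℕ-mono-≤ {m} {n} m≤n = begin
  fromℕ m                   ≡⟨ +-identityʳ (fromℕ m) ⟨
  fromℕ m + 0ℚ              ≤⟨ +-monoʳ-≤ (fromℕ m) (fromℕ≥0 (n ℕ.∸ m)) ⟩
  fromℕ m + fromℕ (n ℕ.∸ m) ≡⟨ fromℕ-+ m (n ℕ.∸ m) ⟨
  fromℕ (m ℕ.+ (n ℕ.∸ m))   ≡⟨ cong fromℕ (ℕ.m+[n∸m]≡n m≤n) ⟩
  fromℕ n                   ∎
  where open ≤-Reasoning

fromℕ-double-pos⁻¹ : ∀ n → 0ℚ < fromℕ n + fromℕ n → 0 ℕ.< n
fromℕ-double-pos⁻¹ zero    0<0 = contradiction 0<0 (<-irrefl refl)
fromℕ-double-pos⁻¹ (suc n) _   = ℕ.z<s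

frac≤⇒≤* : ∀ {q} m n .{{_ : ℕ.NonZero n}} → frac m n ≤ q → fromℕ m ≤ q * fromℕ n
frac≤⇒≤* m n h = subst (_≤ _) (frac-*-cancel m n) (*-monoʳ-≤-nonNeg (fromℕ n) {{fromℕ-nonNeg n}} h)

frac<⇒<* : ∀ {q} m n .{{_ : ℕ.NonZero n}} → frac m n < q → fromℕ m < q * fromℕ n
frac<⇒<* m n h = subst (_< _) (frac-*-cancel m n) (*-monoˡ-<-pos (fromℕ n) {{fromℕ-pos n}} h)

≤frac⇒*≤ : ∀ {q} m n .{{_ : ℕ.NonZero n}} → q ≤ frac m n → q * fromℕ n ≤ fromℕ m
≤frac⇒*≤ m n h = subst (_ ≤_) (frac-*-cancel m n) (*-monoʳ-≤-nonNeg (fromℕ n) {{fromℕ-nonNeg n}} h)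

*≤⇒≤frac : ∀ {q} m n .{{_ : ℕ.NonZero n}} → q * fromℕ n ≤ fromℕ m → q ≤ frac m n
*≤⇒≤frac m n h = *-cancelʳ-≤-pos (fromℕ n) {{fromℕ-pos n}} (subst (_ ≤_) (sym (frac-*-cancel m n)) h)

+-cancelʳ-< : ∀ r {p q} → p + r < q + r → p < q
+-cancelʳ-< r {p} {q} h = subst₂ _<_ (cancel p) (cancel q) (+-monoˡ-< (- r) h)
  where
  cancel : ∀ x → x + r - r ≡ x
  cancel x = solve 2 (λ x r → x :+ r :- r := x) refl x r

*-nonNeg : ∀ {p q} → 0ℚ ≤ p → 0ℚ ≤ q → 0ℚ ≤ p * q
*-nonNeg {p} {q} 0≤p 0≤q =
  nonNegative⁻¹ (p * q) {{nonNeg*nonNeg⇒nonNeg p {{nonNegative 0≤p}} q {{nonNegative 0≤q}}}}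

cut-bound : ∀ {η x y a b c} → a ≤ (1ℚ - η) * x → b < y → x + y ≤ (c + a) + (c + b) →
  η * x < c + c
cut-bound {η} {x} {y} {a} {b} {c} a≤ b< x+y≤ = +-cancelʳ-< k (begin-strict
  η * x + k          ≡⟨ solve 3 (λ η x y → η :* x :+ ((con 1ℚ :- η) :* x :+ y) := x :+ y) refl η x y ⟩
  x + y              ≤⟨ x+y≤ ⟩
  (c + a) + (c + b)  ≡⟨ solve 3 (λ a b c → (c :+ a) :+ (c :+ b) := (c :+ c) :+ (a :+ b)) refl a b c ⟩
  (c + c) + (a + b)  <⟨ +-monoʳ-< (c + c) (+-mono-≤-< a≤ b<) ⟩
  (c + c) + k        ∎)
  where
  open ≤-Reasoning
  k = (1ℚ - η) * x + y

vol-bound : ∀ {η x a c} → 0ℚ ≤ η → η ≤ 1ℚ → 0ℚ ≤ x → 0ℚ ≤ c →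
  a ≤ (1ℚ - η) * x → η * x < c + c → η * (c + a) ≤ (c + c) + c
vol-bound {η} {x} {a} {c} 0≤η η≤1 0≤x 0≤c a≤ ηx< = begin
  η * (c + a)    ≡⟨ *-distribˡ-+ η c a ⟩
  η * c + η * a  ≤⟨ +-mono-≤ ηc≤c (*-monoˡ-≤-nonNeg η {{nonNegative 0≤η}} a≤x) ⟩
  c + η * x      ≤⟨ +-monoʳ-≤ c (<⇒≤ ηx<) ⟩
  c + (c + c)    ≡⟨ +-comm c (c + c) ⟩
  (c + c) + c    ∎
  where
  open ≤-Reasoning
  a≤x : a ≤ x
  a≤x = begin
    a                     ≤⟨ a≤ ⟩
    (1ℚ - η) * x          ≡⟨ +-identityʳ _ ⟨
    (1ℚ - η) * x + 0ℚ     ≤⟨ +-monoʳ-≤ ((1ℚ - η) * x) (*-nonNeg 0≤η 0≤x) ⟩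
    (1ℚ - η) * x + η * x  ≡⟨ solve 2 (λ η x → (con 1ℚ :- η) :* x :+ η :* x := x) refl η x ⟩
    x                     ∎
  ηc≤c : η * c ≤ c
  ηc≤c = subst (η * c ≤_) (*-identityˡ c) (*-monoʳ-≤-nonNeg c {{nonNegative 0≤c}} η≤1)

ratio-bound : ∀ {η v w c} → 0ℚ ≤ v → 0ℚ ≤ w → 0ℚ ≤ c → η * v ≤ (c + c) + c →
  η * (+ 1 / 3) * (v * w) ≤ c * (v + w)
ratio-bound {η} {v} {w} {c} 0≤v 0≤w 0≤c ηv≤ = begin
  η * (+ 1 / 3) * (v * w)      ≡⟨ solve 3 (λ η v w → η :* con (+ 1 / 3) :* (v :* w)
                                                   := con (+ 1 / 3) :* (η :* v) :* w) refl η v w ⟩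
  + 1 / 3 * (η * v) * w        ≤⟨ *-monoʳ-≤-nonNeg w {{nonNegative 0≤w}} (*-monoˡ-≤-nonNeg (+ 1 / 3) ηv≤) ⟩
  + 1 / 3 * ((c + c) + c) * w  ≡⟨ solve 2 (λ c w → con (+ 1 / 3) :* ((c :+ c) :+ c) :* w
                                                   := c :* w :+ con 0ℚ) refl c w ⟩
  c * w + 0ℚ                   ≤⟨ +-monoʳ-≤ (c * w) (*-nonNeg 0≤c 0≤v) ⟩
  c * w + c * v                ≡⟨ solve 3 (λ c v w → c :* w :+ c :* v := c :* (v :+ w)) refl c v w ⟩
  c * (v + w)                  ∎
  where open ≤-Reasoning

conductance-bound : ∀ {η d} A B C {s t} → 0 ℕ.< s → 0 ℕ.< t → 0ℚ ≤ η → η ≤ 1ℚ → 0ℚ ≤ d →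
  frac A s ≤ (1ℚ - η) * d → frac B t < d → d ≤ frac ((C ℕ.+ A) ℕ.+ (C ℕ.+ B)) (s ℕ.+ t) →
  η * (+ 1 / 3) ≤ frac (C ℕ.* ((C ℕ.+ A) ℕ.+ (C ℕ.+ B))) ((C ℕ.+ A) ℕ.* (C ℕ.+ B))
conductance-bound {η} {d} A B C {s} {t} ℕ.z<s ℕ.z<s 0≤η η≤1 0≤d A/s≤ B/t< d≤ =
  *≤⇒≤frac (C ℕ.* (V ℕ.+ W)) (V ℕ.* W) {{VW≢0}}
    (subst₂ _≤_ (cong (η * (+ 1 / 3) *_) (sym (fromℕ-* V W))) (sym num≡)
      (ratio-bound {η} (fromℕ≥0 V) (fromℕ≥0 W) (fromℕ≥0 C) ηv≤))
  where
  open ≤-Reasoning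
  V = C ℕ.+ A
  W = C ℕ.+ B
  a = fromℕ A
  b = fromℕ B
  c = fromℕ C
  x = d * fromℕ s
  y = d * fromℕ t
  a≤ : a ≤ (1ℚ - η) * x
  a≤ = subst (a ≤_) (*-assoc (1ℚ - η) d (fromℕ s)) (frac≤⇒≤* A s A/s≤)
  b< : b < y
  b< = frac<⇒<* B t B/t<
  x+y≤ : x + y ≤ (c + a) + (c + b)
  x+y≤ = begin
    x + y                    ≡⟨ *-distribˡ-+ d (fromℕ s) (fromℕ t) ⟨
    d * (fromℕ s + fromℕ t)  ≡⟨ cong (d *_) (fromℕ-+ s t) ⟨
    d * fromℕ (s ℕ.+ t)      ≤⟨ ≤frac⇒*≤ (V ℕ.+ W) (s ℕ.+ t) d≤ ⟩
    fromℕ (V ℕ.+ W)          ≡⟨ trans (fromℕ-+ V W) (cong₂ _+_ (fromℕ-+ C A) (fromℕ-+ C B)) ⟩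
    (c + a) + (c + b)        ∎
  ηx< : η * x < c + c
  ηx< = cut-bound {η} {x} {c = c} a≤ b< x+y≤
  ηv≤ : η * fromℕ V ≤ (c + c) + c
  ηv≤ = subst (λ v → η * v ≤ (c + c) + c) (sym (fromℕ-+ C A))
          (vol-bound 0≤η η≤1 (*-nonNeg 0≤d (fromℕ≥0 s)) (fromℕ≥0 C) a≤ ηx<)
  0<C : 0 ℕ.< C
  0<C = fromℕ-double-pos⁻¹ C (≤-<-trans (*-nonNeg 0≤η (*-nonNeg 0≤d (fromℕ≥0 s))) ηx<)
  VW≢0 : ℕ.NonZero (V ℕ.* W)
  VW≢0 = ℕ.>-nonZero (ℕ.*-mono-< (ℕ.<-≤-trans 0<C (ℕ.m≤m+n C A)) (ℕ.<-≤-trans 0<C (ℕ.m≤m+n C B)))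
  num≡ : fromℕ (C ℕ.* (V ℕ.+ W)) ≡ c * (fromℕ V + fromℕ W)
  num≡ = trans (fromℕ-* C (V ℕ.+ W)) (cong (c *_) (fromℕ-+ V W))

conductance-∁ : ∀ {n} (G : Graph n) S → conductance G (∁ S) ≡ conductance G S
conductance-∁ G S = cong₂ frac (cong (ℕ._* twoM G) (cut-∁ G S))
  (trans (cong (λ T → vol G (∁ S) ℕ.* vol G T) (∁-involutive S)) (ℕ.*-comm (vol G (∁ S)) (vol G S)))

small-side-bound : ∀ {n} {d η} (G : Graph n) (S : Subset n) → Minimal d G → 0ℚ ≤ η → η ≤ 1ℚ → 0ℚ ≤ d →
  (∃ λ i → i ∈ S) → (∃ λ j → j ∉ S) → avgDegInd G S ≤ (1ℚ - η) * d →
  η * (+ 1 / 3) ≤ conductance G S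
small-side-bound {n} {d} {η} G S (d≤avgDeg , proper-sparse) 0≤η η≤1 0≤d (i , i∈S) (j , j∉S) dS≤ =
  subst₂ (λ num den → η * (+ 1 / 3) ≤ frac num den)
    (cong (C ℕ.*_) (sym 2m≡)) (sym (cong₂ ℕ._*_ volS≡ volSᶜ≡))
    (conductance-bound A B C (x∈p⇒∣p∣>0 i∈S) (x∈p⇒∣p∣>0 (x∉p⇒x∈∁p j∉S))
      0≤η η≤1 0≤d dS≤ dSᶜ< d≤)
  where
  A = arcs G (lookup S) (lookup S)
  B = arcs G (lookup (∁ S)) (lookup (∁ S))
  C = cut G S
  volS≡ : vol G S ≡ C ℕ.+ A
  volS≡ = vol≡cut+arcs G S
  volSᶜ≡ : vol G (∁ S) ≡ C ℕ.+ B
  volSᶜ≡ = trans (vol≡cut+arcs G (∁ S)) (cong (ℕ._+ B) (cut-∁ G S))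
  2m≡ : twoM G ≡ (C ℕ.+ A) ℕ.+ (C ℕ.+ B)
  2m≡ = trans (twoM≡vol+vol∁ G S) (cong₂ ℕ._+_ volS≡ volSᶜ≡)
  dSᶜ< : avgDegInd G (∁ S) < d
  dSᶜ< = proper-sparse (induced G (∁ S)) (induced-proper G (x∈p⇒x∉∁p i∈S))
  d≤ : d ≤ frac ((C ℕ.+ A) ℕ.+ (C ℕ.+ B)) (∣ S ∣ ℕ.+ ∣ ∁ S ∣)
  d≤ = subst₂ (λ m k → d ≤ frac m k) 2m≡ (sym (∣p∣+∣∁p∣≡n S)) d≤avgDeg

half-≤-scaled : ∀ {ε} {m n} → ε ≤ ½ → m ℕ.+ m ℕ.≤ n → frac m 1 ≤ (1ℚ - ε) * frac n 1
half-≤-scaled {ε} {m} {n} ε≤½ m+m≤n = begin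
  fromℕ m                  ≡⟨ solve 1 (λ x → x := con ½ :* (x :+ x)) refl (fromℕ m) ⟩
  ½ * (fromℕ m + fromℕ m)  ≡⟨ cong (½ *_) (fromℕ-+ m m) ⟨
  ½ * fromℕ (m ℕ.+ m)      ≤⟨ *-monoˡ-≤-nonNeg ½ (fromℕ-mono-≤ m+m≤n) ⟩
  ½ * fromℕ n              ≤⟨ *-monoʳ-≤-nonNeg (fromℕ n) {{fromℕ-nonNeg n}} ½≤1-ε ⟩
  (1ℚ - ε) * fromℕ n       ∎
  where
  open ≤-Reasoning
  ½≤1-ε : ½ ≤ 1ℚ - ε
  ½≤1-ε = begin
    ½                     ≡⟨ solve 1 (λ e → con ½ := e :+ ((con 1ℚ :- e) :- con ½)) refl ε ⟩
    ε + ((1ℚ - ε) - ½)    ≤⟨ +-monoˡ-≤ ((1ℚ - ε) - ½) ε≤½ ⟩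
    ½ + ((1ℚ - ε) - ½)    ≡⟨ solve 1 (λ e → con ½ :+ ((con 1ℚ :- e) :- con ½) := con 1ℚ :- e) refl ε ⟩
    1ℚ - ε                ∎

lemma23 : (d η ε : ℚ) → 1ℚ ≤ d → 0ℚ < η → η < 1ℚ → 0ℚ < ε → ε ≤ ½ →
    (n : ℕ) (G : Graph n) → Expander d η ε G →
    ConductanceAtLeast G (η * (+ 1 / 3))
lemma23 d η ε 1≤d 0<η η<1 _ ε≤½ n G (minimal , expanding) S (i , i∈S) (j , j∉S) =
  [ bound S (i , i∈S) (j , j∉S)
  , (λ Sᶜ-small → subst (η * (+ 1 / 3) ≤_) (conductance-∁ G S)
      (bound (∁ S) (j , x∉p⇒x∈∁p j∉S) (i , x∈p⇒x∉∁p i∈S) Sᶜ-small))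
  ]′ (∣p∣+∣p∣≤n⊎∣∁p∣+∣∁p∣≤n S)
  where
  bound : ∀ T → (∃ λ i → i ∈ T) → (∃ λ j → j ∉ T) → ∣ T ∣ ℕ.+ ∣ T ∣ ℕ.≤ n →
    η * (+ 1 / 3) ≤ conductance G T
  bound T nonempty proper small =
    small-side-bound G T minimal (<⇒≤ 0<η) (<⇒≤ η<1) (≤-trans (nonNegative⁻¹ 1ℚ) 1≤d) nonempty proper
      (expanding T (half-≤-scaled {ε} {∣ T ∣} ε≤½ small))
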